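{- Let $a,b,c,d,e,f,g,h,i$ be integers such that $a^2,b^2,\dots,i^2$ are nine distinct integers arranged in the $3\times 3$ grid $$\begin{array}{c|c|c} a^2 & b^2 & c^2\\ \hline d^2 & e^2 & f^2\\ \hline g^2 & h^2 & i^2\end{array}$$ such that the entries of each row, each column, and each of the two main diagonals sum to the same total. If the central entry $e^2$ is even, then at least one of the following triples consists entirely of even numbers: the central column $(b^2,e^2,h^2)$, the central row $(d^2,e^2,f^2)$, the main diagonal $(a^2,e^2,i^2)$, or the anti-diagonal $(c^2,e^2,g^2)$.
   Context: Such a grid is called a magic square of squares; $e^2$ is its central entry. -}

module Defs where

open import Data.Integer using (ℤ; _+_; _*_; +_)
open import Data.Integer.Divisibility using (_∣_)
open import Data.List using (List; _∷_; [])
open import Data.List.Relation.Unary.AllPairs using (AllPairs)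
open import Relation.Binary.PropositionalEquality using (_≡_; _≢_)
open import Data.Product using (_×_)

sq : ℤ → ℤ
sq x = x * x

Even : ℤ → Set
Even x = + 2 ∣ x

Distinct : List ℤ → Set
Distinct = AllPairs _≢_

IsMagic : (a b c d e f g h i : ℤ) → Set
IsMagic a b c d e f g h i =
  let s = a + b + c in
  (d + e + f ≡ s) × (g + h + i ≡ s) ×
  (a + d + g ≡ s) × (b + e + h ≡ s) × (c + f + i ≡ s) ×
  (a + e + i ≡ s) × (c + e + g ≡ s)

IsMagicSquareOfSquares : (a b c d e f g h i : ℤ) → Set
IsMagicSquareOfSquares a b c d e f g h i =
  Distinct (sq a ∷ sq b ∷ sq c ∷ sq d ∷ sq e ∷ sq f ∷ sq g ∷ sq h ∷ sq i ∷ []) ×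
  IsMagic (sq a) (sq b) (sq c) (sq d) (sq e) (sq f) (sq g) (sq h) (sq i)

{-# OPTIONS --safe #-}
-- The three lines through the centre add up to 3s and the top and bottom
-- rows to 2s, so the magic sum is 3e² and b² + h² = 2e².  If e² is even then
-- so is e, hence 2e² ≡ 0 (mod 8), and since odd squares are 1 (mod 4) a sum
-- of two squares divisible by 4 has both summands even.  So the central
-- column is always the even triple; distinctness of the entries is not needed.
module Submission where

open import Defs
open import Data.Integer using (ℤ; +_; _+_; _*_; _-_)
open import Data.Integer.Properties using (+-comm; *-cancelˡ-≡)
open import Data.Integer.DivMod using (_%ℕ_; _/ℕ_; a≡a%ℕn+[a/ℕn]*n; n%ℕd<d)
import Data.Integer.Divisibility.Signed as Signed
open import Data.Integer.Tactic.RingSolver using (solve-∀)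
import Data.Nat as ℕ
import Data.Nat.Divisibility as ℕ
open import Data.Product using (_×_; _,_; ∃-syntax)
open import Data.Sum using (_⊎_; inj₁)
open import Data.Empty using (⊥-elim)
open import Relation.Nullary using (¬_)
open import Relation.Binary.PropositionalEquality

magic-centre-column : ∀ a b c d e f g h i → IsMagic a b c d e f g h i →
                      b + h ≡ + 2 * e
magic-centre-column a b c d e f g h i
                    (_ , bottom , _ , _ , _ , diagonal , antidiagonal) = begin
  b + h                                                 ≡⟨ identity a b c e g h i ⟩
  (g + h + i) - (a + e + i) - (c + e + g) + s + + 2 * e ≡⟨ cong₂ (λ u v → u - v - (c + e + g) + s + + 2 * e) bottom diagonal ⟩
  s - s - (c + e + g) + s + + 2 * e                     ≡⟨ cong (λ w → s - s - w + s + + 2 * e) antidiagonal ⟩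
  s - s - s + s + + 2 * e                               ≡⟨ cancel s e ⟩
  + 2 * e                                               ∎
  where
  open ≡-Reasoning
  s = a + b + c
  identity : ∀ a b c e g h i →
             b + h ≡ (g + h + i) - (a + e + i) - (c + e + g) + (a + b + c) + + 2 * e
  identity = solve-∀
  cancel : ∀ s e → s - s - s + s + + 2 * e ≡ + 2 * e
  cancel = solve-∀

data Parity (x : ℤ) : Set where
  even : ∀ k → x ≡ + 2 * k → Parity x
  odd  : ∀ k → x ≡ + 2 * k + + 1 → Parity x

parity : ∀ x → Parity x
parity x with x %ℕ 2 | n%ℕd<d x 2 | a≡a%ℕn+[a/ℕn]*n x 2
... | 0 | _ | x≡ = even (x /ℕ 2) (trans x≡ (rearrange (x /ℕ 2)))
  where rearrange : ∀ q → + 0 + q * + 2 ≡ + 2 * q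
        rearrange = solve-∀
... | 1 | _ | x≡ = odd (x /ℕ 2) (trans x≡ (rearrange (x /ℕ 2)))
  where rearrange : ∀ q → + 1 + q * + 2 ≡ + 2 * q + + 1
        rearrange = solve-∀
... | ℕ.suc (ℕ.suc _) | ℕ.s≤s (ℕ.s≤s ()) | _

even-double : ∀ k → Even (+ 2 * k)
even-double k = Signed.∣⇒∣ᵤ (Signed.∣m⇒∣m*n {+ 2} k Signed.∣-refl)

one-not-even : ¬ Even (+ 1)
one-not-even 2∣1 with ℕ.∣⇒≤ 2∣1
... | ℕ.s≤s ()

odd-not-even : ∀ k → ¬ Even (+ 2 * k + + 1)
odd-not-even k 2∣2k+1 =
  one-not-even (Signed.∣⇒∣ᵤ (Signed.∣m+n∣m⇒∣n {+ 2} {+ 2 * k} {+ 1} (Signed.∣ᵤ⇒∣ 2∣2k+1) (Signed.∣ᵤ⇒∣ (even-double k))))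

odd≢even : ∀ k m → + 2 * k + + 1 ≢ + 2 * m
odd≢even k m 2k+1≡2m = odd-not-even k (subst Even (sym 2k+1≡2m) (even-double m))

even⇒even-sq : ∀ x → Even x → Even (sq x)
even⇒even-sq x 2∣x = Signed.∣⇒∣ᵤ (Signed.∣m⇒∣m*n {+ 2} {x} x (Signed.∣ᵤ⇒∣ 2∣x))

even-sq⇒sq≡4* : ∀ x → Even (sq x) → ∃[ n ] sq x ≡ + 4 * n
even-sq⇒sq≡4* x 2∣x² with parity x
... | even k refl = k * k , square k
  where square : ∀ k → (+ 2 * k) * (+ 2 * k) ≡ + 4 * (k * k)
        square = solve-∀
... | odd k refl = ⊥-elim (odd-not-even (+ 2 * k * k + + 2 * k) (subst Even (square k) 2∣x²))
  where square : ∀ k → (+ 2 * k + + 1) * (+ 2 * k + + 1) ≡ + 2 * (+ 2 * k * k + + 2 * k) + + 1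
        square = solve-∀

sq+sq≡4*⇒even : ∀ x y {n} → sq x + sq y ≡ + 4 * n → Even x
sq+sq≡4*⇒even x y {n} x²+y²≡4n with parity x | parity y
... | even k refl | _ = even-double k
... | odd k refl | even j refl =
  ⊥-elim (odd≢even (+ 2 * k * k + + 2 * k + + 2 * j * j) (+ 2 * n) (trans (sym (sum k j)) (trans x²+y²≡4n (four n))))
  where sum : ∀ k j → (+ 2 * k + + 1) * (+ 2 * k + + 1) + (+ 2 * j) * (+ 2 * j) ≡ + 2 * (+ 2 * k * k + + 2 * k + + 2 * j * j) + + 1
        sum = solve-∀
        four : ∀ n → + 4 * n ≡ + 2 * (+ 2 * n)
        four = solve-∀
... | odd k refl | odd j refl =
  ⊥-elim (odd≢even (k * k + k + j * j + j) n (*-cancelˡ-≡ (+ 2) _ _ (trans (sym (sum k j)) (trans x²+y²≡4n (four n)))))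
  where sum : ∀ k j → (+ 2 * k + + 1) * (+ 2 * k + + 1) + (+ 2 * j + + 1) * (+ 2 * j + + 1) ≡ + 2 * (+ 2 * (k * k + k + j * j + j) + + 1)
        sum = solve-∀
        four : ∀ n → + 4 * n ≡ + 2 * (+ 2 * n)
        four = solve-∀

corollary3p1 : (a b c d e f g h i : ℤ) →
    IsMagicSquareOfSquares a b c d e f g h i →
    Even (sq e) →
    (Even (sq b) × Even (sq e) × Even (sq h)) ⊎
    (Even (sq d) × Even (sq e) × Even (sq f)) ⊎
    (Even (sq a) × Even (sq e) × Even (sq i)) ⊎
    (Even (sq c) × Even (sq e) × Even (sq g))
corollary3p1 a b c d e f g h i (_ , magic) e²-even
  with n , e²≡4n ← even-sq⇒sq≡4* e e²-even =
  inj₁ (even⇒even-sq b b-even , e²-even , even⇒even-sq h h-even)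
  where
  open ≡-Reasoning
  regroup : ∀ n → + 2 * (+ 4 * n) ≡ + 4 * (+ 2 * n)
  regroup = solve-∀
  b²+h²≡4*2n : sq b + sq h ≡ + 4 * (+ 2 * n)
  b²+h²≡4*2n = begin
    sq b + sq h     ≡⟨ magic-centre-column (sq a) (sq b) (sq c) (sq d) (sq e) (sq f) (sq g) (sq h) (sq i) magic ⟩
    + 2 * sq e      ≡⟨ cong (+ 2 *_) e²≡4n ⟩
    + 2 * (+ 4 * n) ≡⟨ regroup n ⟩
    + 4 * (+ 2 * n) ∎
  b-even : Even b
  b-even = sq+sq≡4*⇒even b h b²+h²≡4*2n
  h-even : Even h
  h-even = sq+sq≡4*⇒even h b (trans (+-comm (sq h) (sq b)) b²+h²≡4*2n)
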